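{- Let $k\geq 2$ be an integer and let $G=(D\cup I,E)$ be a split graph such that its corresponding hypergraph $H(G)$ is $k$-uniform and admits a panchromatic $k$-coloring. If $\alpha_k(H(G))\geq 1$, then $G$ does not have $k$ completely independent spanning trees.
   Context: A split graph $G=(D\cup I,E)$ is a graph whose vertex set is partitioned into a clique $D$ and an independent set $I$; the paper assumes throughout that every vertex of $D$ is adjacent to at least one vertex of $I$. Its corresponding hypergraph is $H(G)=(D,\mathcal{E})$ with $\mathcal{E}=\{N_G(x) : x\in I\}$ (one hyperedge for each $x\in I$); it is $k$-uniform if every vertex of $I$ has exactly $k$ neighbors. A panchromatic $k$-coloring of a hypergraph is an assignment of colors from $\{1,\dots,k\}$ to its vertices such that every hyperedge contains at least one vertex of each of the $k$ colors. A color is unique if it is assigned to exactly one vertex. $\alpha_k(H)$ denotes the minimum, over all panchromatic $k$-colorings of $H$, of the number of vertices whose color is unique. Spanning trees $T_1,\dots,T_k$ of a graph are completely independent spanning trees if for every pair of vertices $x,y$ the $(x,y)$-paths in $T_1,\dots,T_k$ are pairwise edge-disjoint and have no common internal vertex. -}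

module Defs where

open import Data.Nat using (ℕ; zero; suc; _+_; _≤_)
open import Data.Bool using (Bool; true; false; _∧_; if_then_else_)
open import Data.Fin using (Fin; _≟_)
open import Data.List using (List; []; _∷_; length; map; allFin)
open import Data.Nat.ListAction using (sum)
open import Data.List.Membership.Propositional using (_∈_)
open import Data.List.Relation.Unary.Unique.Propositional using (Unique)
open import Data.Product using (Σ; _×_; _,_; ∃)
open import Data.Sum using (_⊎_)
open import Data.Empty using (⊥)
open import Relation.Nullary using (¬_; does)
open import Relation.Binary.PropositionalEquality using (_≡_; _≢_)

record Graph (n : ℕ) : Set where
  field
    adj   : Fin n → Fin n → Bool
    sym   : ∀ x y → adj x y ≡ adj y x
    irrefl : ∀ x → adj x x ≡ false
open Graph public

countB : {n : ℕ} → (Fin n → Bool) → ℕ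
countB {n} p = sum (map (λ v → if p v then 1 else 0) (allFin n))

-- Split graphs.  inD v ≡ true means v ∈ D, inD v ≡ false means v ∈ I.

record IsSplit {n : ℕ} (G : Graph n) (inD : Fin n → Bool) : Set where
  field
    clique      : ∀ x y → inD x ≡ true → inD y ≡ true → x ≢ y → adj G x y ≡ true
    independent : ∀ x y → inD x ≡ false → inD y ≡ false → adj G x y ≡ false
    -- standing assumption: every vertex of D has a neighbour in I
    dominated   : ∀ x → inD x ≡ true → ∃ λ y → inD y ≡ false × adj G x y ≡ true

-- The hypergraph H(G) = (D, { N_G(x) : x ∈ I }).

Uniform : {n : ℕ} → Graph n → (Fin n → Bool) → ℕ → Set
Uniform G inD k = ∀ x → inD x ≡ false → countB (adj G x) ≡ k

-- A k-colouring of H(G): a colour for each vertex (only the colours of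
-- vertices in D are ever inspected).
-- Panchromatic: every hyperedge N_G(x), x ∈ I, sees every colour.
Panchromatic : {n : ℕ} → Graph n → (Fin n → Bool) → (k : ℕ) → (Fin n → Fin k) → Set
Panchromatic G inD k c =
  ∀ x → inD x ≡ false → ∀ (i : Fin k) →
    ∃ λ y → adj G x y ≡ true × c y ≡ i

hasUniqueColour : {n k : ℕ} → (Fin n → Bool) → (Fin n → Fin k) → Fin n → Bool
hasUniqueColour inD c v =
  inD v ∧ (countB (λ w → inD w ∧ does (c w ≟ c v)) Data.Nat.≡ᵇ 1)

numUnique : {n k : ℕ} → (Fin n → Bool) → (Fin n → Fin k) → ℕ
numUnique inD c = countB (hasUniqueColour inD c)

-- α_k(H(G)) ≥ 1: every panchromatic k-colouring has a vertex of unique colour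
-- (α_k is the minimum of numUnique over panchromatic colourings).
AlphaAtLeast1 : {n : ℕ} → Graph n → (Fin n → Bool) → ℕ → Set
AlphaAtLeast1 {n} G inD k =
  ∀ (c : Fin n → Fin k) → Panchromatic G inD k c → 1 ≤ numUnique inD c

module _ {n : ℕ} (r : Fin n → Fin n → Bool) where

  data Walk : Fin n → Fin n → Set where
    []  : ∀ {x} → Walk x x
    _∷_ : ∀ {x y z} → r x y ≡ true → Walk y z → Walk x z

  initVertices : ∀ {x y} → Walk x y → List (Fin n)
  initVertices []               = []
  initVertices (_∷_ {x} _ w)    = x ∷ initVertices w

  vertices : ∀ {x y} → Walk x y → List (Fin n)
  vertices {x} []            = x ∷ []
  vertices (_∷_ {x} _ w)     = x ∷ vertices w

  internal : ∀ {x y} → Walk x y → List (Fin n)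
  internal []      = []
  internal (_ ∷ w) = initVertices w

  edges : ∀ {x y} → Walk x y → List (Fin n × Fin n)
  edges []                    = []
  edges (_∷_ {x} {y} _ w)     = (x , y) ∷ edges w

  IsPath : ∀ {x y} → Walk x y → Set
  IsPath w = Unique (vertices w)

  IsCycle : ∀ {x} → Walk x x → Set
  IsCycle w = 3 ≤ length (initVertices w) × Unique (initVertices w)

  Connected : Set
  Connected = ∀ x y → Walk x y

  Acyclic : Set
  Acyclic = ∀ x (w : Walk x x) → ¬ IsCycle w

SameEdge : {n : ℕ} → Fin n × Fin n → Fin n × Fin n → Set
SameEdge (a , b) (c , d) = (a ≡ c × b ≡ d) ⊎ (a ≡ d × b ≡ c)

record SpanningTree {n : ℕ} (G : Graph n) : Set where
  field
    tadj     : Fin n → Fin n → Bool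
    tsym     : ∀ x y → tadj x y ≡ tadj y x
    subgraph : ∀ x y → tadj x y ≡ true → adj G x y ≡ true
    connected : Connected tadj
    acyclic   : Acyclic tadj
open SpanningTree public

CompletelyIndependent : {n k : ℕ} {G : Graph n} → (Fin k → SpanningTree G) → Set
CompletelyIndependent {n} {k} T =
  ∀ (i j : Fin k) → i ≢ j → ∀ (x y : Fin n) →
  ∀ (P : Walk (tadj (T i)) x y) (Q : Walk (tadj (T j)) x y) →
  IsPath (tadj (T i)) P → IsPath (tadj (T j)) Q →
    (∀ e f → e ∈ edges (tadj (T i)) P → f ∈ edges (tadj (T j)) Q → ¬ SameEdge e f)
  × (∀ v → v ∈ internal (tadj (T i)) P → v ∈ internal (tadj (T j)) Q → ⊥)

-- No edge lies in two of the trees T₁, …, T_k and, since any two vertices separated by v in two trees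
-- would have their paths meet at v, every vertex is inner (of tree degree ≥ 2) in at most one tree.
-- Colouring a vertex by the tree in which it is inner gives a panchromatic colouring of H(G): for
-- x ∈ I the T_i-path from x to a T_j-neighbour of x (j ≠ i) is not a single edge, so its second
-- vertex is a neighbour of x inner in T_i.  As α_k ≥ 1, some v ∈ D is alone in D with its colour i,
-- so every vertex of I is joined to v in T_i.  Hence v has a T_j-neighbour w ∈ D inner in T_j, w has
-- a T_i-neighbour p ∈ I inner in T_i, and p has a T_j-neighbour inner in T_j; since the hyperedge N(p)
-- has exactly one vertex of each colour, that neighbour is w, so the edge pw lies in T_i and in T_j.
module Submission where

open import Defs hiding (sym)
open import Data.Nat using (ℕ; zero; suc; _+_; _≤_; z≤n; s≤s)
open import Data.Nat.Properties using (+-suc; <⇒≱; ≤-reflexive; ≡ᵇ⇒≡)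
open import Data.Nat.ListAction using (sum)
open import Data.Bool using (Bool; true; false; _∧_; _∨_; if_then_else_; T)
open import Data.Bool.Properties using (∨-comm) renaming (_≟_ to _≟ᵇ_)
open import Data.Fin using (Fin; zero; suc; _≟_; punchIn)
open import Data.Fin.Properties using (any?; punchInᵢ≢i)
open import Data.List using (List; []; _∷_; length; map; allFin)
open import Data.List.Properties using (map-tabulate; length-map; length-tabulate)
open import Data.List.Membership.Propositional using (_∈_; _∉_)
import Data.List.Membership.DecPropositional as DecMembership
open import Data.List.Relation.Unary.Any using (here; there)
open import Data.List.Relation.Unary.All as All using (All; []; _∷_)
import Data.List.Relation.Unary.All.Properties as All
open import Data.List.Relation.Unary.AllPairs using ([]; _∷_)
open import Data.List.Relation.Unary.Unique.Propositional using (Unique)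
import Data.List.Relation.Unary.Unique.Propositional.Properties as Unique
open import Data.Product using (Σ; ∃; ∃₂; _×_; _,_; proj₁; proj₂)
open import Data.Sum using (inj₁)
open import Data.Empty using (⊥; ⊥-elim)
open import Data.Unit using (tt)
open import Function using (_∘_; id; Injective)
open import Relation.Binary.Core using (Rel)
open import Relation.Binary.Structures using (IsPartialEquivalence)
open import Relation.Nullary using (¬_; Dec; yes; no; does)
open import Relation.Nullary.Decidable
  using (dec-true; dec-false; decidable-stable; ¬?; _×-dec_; ¬¬-excluded-middle)
open import Relation.Binary.PropositionalEquality
  using (_≡_; _≢_; refl; sym; trans; cong; cong₂; subst; module ≡-Reasoning)

private
  variable
    n : ℕ

countB-suc : (p : Fin (suc n) → Bool) →
  countB p ≡ (if p zero then 1 else 0) + countB (p ∘ suc)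
countB-suc {n} p = cong (indicator zero +_)
  (trans (cong sum (map-tabulate suc indicator))
         (sym (cong sum (map-tabulate id (indicator ∘ suc)))))
  where
  indicator : Fin (suc n) → ℕ
  indicator v = if p v then 1 else 0

countB-pos : (p : Fin n → Bool) → 1 ≤ countB p → ∃ λ v → p v ≡ true
countB-pos {zero}  p ()
countB-pos {suc n} p 1≤count with p zero in p0 | countB-suc p
... | true  | _     = zero , p0
... | false | count =
  let v , pv = countB-pos (p ∘ suc) (subst (1 ≤_) count 1≤count) in suc v , pv

without : (Fin n → Bool) → Fin n → Fin n → Bool
without p x v = if does (v ≟ x) then false else p v

without-true : (p : Fin n → Bool) {x v : Fin n} → x ≢ v → p v ≡ true → without p x v ≡ true
without-true p {x} {v} x≢v pv rewrite dec-false (v ≟ x) (x≢v ∘ sym) = pv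

countB-without : (p : Fin n → Bool) {x : Fin n} → p x ≡ true →
  countB p ≡ suc (countB (without p x))
countB-without p {zero} px = begin
  countB p                                         ≡⟨ countB-suc p ⟩
  (if p zero then 1 else 0) + countB (p ∘ suc)     ≡⟨ cong (λ b → (if b then 1 else 0) + countB (p ∘ suc)) px ⟩
  suc (countB (p ∘ suc))                           ≡⟨ cong suc (sym (countB-suc (without p zero))) ⟩
  suc (countB (without p zero))                    ∎
  where open ≡-Reasoning
countB-without p {suc x} px = begin
  countB p                                         ≡⟨ countB-suc p ⟩
  p₀ + countB (p ∘ suc)                            ≡⟨ cong (p₀ +_) (countB-without (p ∘ suc) px) ⟩
  p₀ + suc (countB (without (p ∘ suc) x))          ≡⟨ +-suc p₀ _ ⟩
  suc (p₀ + countB (without (p ∘ suc) x))          ≡⟨ cong suc (sym (countB-suc (without p (suc x)))) ⟩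
  suc (countB (without p (suc x)))                 ∎
  where
  open ≡-Reasoning
  p₀ = if p zero then 1 else 0

length≤countB : (p : Fin n → Bool) {xs : List (Fin n)} →
  Unique xs → All (λ v → p v ≡ true) xs → length xs ≤ countB p
length≤countB p []                  []         = z≤n
length≤countB p (x≢xs ∷ xs-unique) (px ∷ pxs) =
  subst (_ ≤_) (sym (countB-without p px))
    (s≤s (length≤countB (without p _) xs-unique (All.zipWith (λ (x≢v , pv) → without-true p x≢v pv) (x≢xs , pxs))))

countB≤-injection-onto : ∀ {k} (p : Fin n → Bool) → countB p ≤ k →
  (f : Fin k → Fin n) → Injective _≡_ _≡_ f → (∀ l → p (f l) ≡ true) →
  ∀ {v} → p v ≡ true → ∃ λ l → f l ≡ v
countB≤-injection-onto {n} {k} p count≤k f f-injective pf {v} pv with any? (λ l → f l ≟ v)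
... | yes hit = hit
... | no miss = ⊥-elim (<⇒≱ (subst (_≤ countB p) length-image (length≤countB p image-unique image-p)) count≤k)
  where
  image : List (Fin n)
  image = v ∷ map f (allFin k)
  image-unique : Unique image
  image-unique = All.map⁺ (All.universal (λ l v≡fl → miss (l , sym v≡fl)) (allFin k))
               ∷ Unique.map⁺ f-injective (Unique.allFin⁺ k)
  image-p : All (λ w → p w ≡ true) image
  image-p = pv ∷ All.map⁺ (All.universal pf (allFin k))
  length-image : length image ≡ suc k
  length-image = cong suc (trans (length-map f (allFin k)) (length-tabulate id))

countB≡1⇒unique : (p : Fin n → Bool) → countB p ≡ 1 →
  ∀ {a b} → p a ≡ true → p b ≡ true → a ≡ b
countB≡1⇒unique p count≡1 {a} pa pb =
  proj₂ (countB≤-injection-onto p (≤-reflexive count≡1) (λ _ → a) (λ { {zero} {zero} _ → refl }) (λ _ → pa) pb)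

module _ {ℓ ℓ₁ ℓ₂} {A : Set ℓ} {R : Rel A ℓ₁} {S : Rel A ℓ₂}
         (R-isPE : IsPartialEquivalence R) (S-isPE : IsPartialEquivalence S) where

  private
    module R = IsPartialEquivalence R-isPE
    module S = IsPartialEquivalence S-isPE

  -- Classically: if c R d, some x ∈ {a, b} is R-unrelated to both c and d, hence S-related to both.
  ¬¬-jointlyUnrelated : ∀ {a b c d} → ¬ R a b → ¬ S c d →
    ¬ ¬ (∃₂ λ y z → ¬ R y z × ¬ S y z)
  ¬¬-jointlyUnrelated {a} {b} {c} {d} ¬Rab ¬Scd none =
    ¬¬Rcd λ Rcd → ¬¬-excluded-middle λ
      { (no ¬Rac) → apart ¬Rac (λ Rad → ¬Rac (R.trans Rad (R.sym Rcd)))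
      ; (yes Rac) → apart (λ Rbc → ¬Rab (R.trans Rac (R.sym Rbc)))
                          (λ Rbd → ¬Rab (R.trans Rac (R.sym (R.trans Rbd (R.sym Rcd)))))
      }
    where
    ¬¬S : ∀ {y z} → ¬ R y z → ¬ ¬ S y z
    ¬¬S ¬Ryz ¬Syz = none (_ , _ , ¬Ryz , ¬Syz)
    ¬¬Rcd : ¬ ¬ R c d
    ¬¬Rcd ¬Rcd = none (c , d , ¬Rcd , ¬Scd)
    apart : ∀ {x} → ¬ R x c → ¬ R x d → ⊥
    apart ¬Rxc ¬Rxd = ¬¬S ¬Rxc λ Sxc → ¬¬S ¬Rxd λ Sxd → ¬Scd (S.trans (S.sym Sxc) Sxd)

module _ {r : Fin n → Fin n → Bool} where

  open DecMembership (_≟_ {n}) using (_∈?_)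

  infixr 5 _◅◅_
  _◅◅_ : ∀ {x y z} → Walk r x y → Walk r y z → Walk r x z
  []      ◅◅ w = w
  (e ∷ v) ◅◅ w = e ∷ (v ◅◅ w)

  initVertices-◅◅-edge : ∀ {x y z} (w : Walk r x y) (e : r y z ≡ true) →
    initVertices r (w ◅◅ (e ∷ [])) ≡ vertices r w
  initVertices-◅◅-edge []      e = refl
  initVertices-◅◅-edge (_ ∷ w) e = cong (_ ∷_) (initVertices-◅◅-edge w e)

  reverse : (∀ x y → r x y ≡ r y x) → ∀ {x y} → Walk r x y → Walk r y x
  reverse r-sym []                  = []
  reverse r-sym (_∷_ {x} {y} e w) = reverse r-sym w ◅◅ (trans (r-sym y x) e ∷ [])

  start∈vertices : ∀ {x y} (w : Walk r x y) → x ∈ vertices r w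
  start∈vertices []      = here refl
  start∈vertices (_ ∷ _) = here refl

  1≤length-vertices : ∀ {x y} (w : Walk r x y) → 1 ≤ length (vertices r w)
  1≤length-vertices []      = s≤s z≤n
  1≤length-vertices (_ ∷ _) = s≤s z≤n

  ∈-initVertices : ∀ {x y u} (w : Walk r x y) → u ∈ vertices r w → u ≢ y → u ∈ initVertices r w
  ∈-initVertices []      (here refl) u≢y = ⊥-elim (u≢y refl)
  ∈-initVertices (_ ∷ _) (here refl) _   = here refl
  ∈-initVertices (_ ∷ w) (there u∈w) u≢y = there (∈-initVertices w u∈w u≢y)

  ∈-internal : ∀ {x y u} (w : Walk r x y) → u ∈ vertices r w → u ≢ x → u ≢ y → u ∈ internal r w
  ∈-internal []      (here refl) u≢x _   = ⊥-elim (u≢x refl)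
  ∈-internal (_ ∷ _) (here refl) u≢x _   = ⊥-elim (u≢x refl)
  ∈-internal (_ ∷ w) (there u∈w) _   u≢y = ∈-initVertices w u∈w u≢y

  dropUntil : ∀ {x y z} (p : Walk r y z) → x ∈ vertices r p → IsPath r p →
    Σ (Walk r x z) (IsPath r)
  dropUntil []      (here refl) p-path       = [] , p-path
  dropUntil (e ∷ p) (here refl) p-path       = e ∷ p , p-path
  dropUntil (_ ∷ p) (there x∈p) (_ ∷ p-path) = dropUntil p x∈p p-path

  toPath : ∀ {x y} → Walk r x y → Σ (Walk r x y) (IsPath r)
  toPath [] = [] , [] ∷ []
  toPath (_∷_ {x} e w) with toPath w
  ... | p , p-path with x ∈? vertices r p
  ...   | yes x∈p = dropUntil p x∈p p-path
  ...   | no  x∉p = e ∷ p , All.¬Any⇒All¬ _ x∉p ∷ p-path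

mapWalk : {r s : Fin n → Fin n → Bool} → (∀ {x y} → r x y ≡ true → s x y ≡ true) →
  ∀ {x y} → Walk r x y → Walk s x y
mapWalk f []      = []
mapWalk f (e ∷ w) = f e ∷ mapWalk f w

vertices-mapWalk : {r s : Fin n → Fin n → Bool} (f : ∀ {x y} → r x y ≡ true → s x y ≡ true) →
  ∀ {x y} (w : Walk r x y) → vertices s (mapWalk f w) ≡ vertices r w
vertices-mapWalk f []      = refl
vertices-mapWalk f (_ ∷ w) = cong (_ ∷_) (vertices-mapWalk f w)

_∖_ : (Fin n → Fin n → Bool) → Fin n → Fin n → Fin n → Bool
(r ∖ v) x y = if does (x ≟ v) ∨ does (y ≟ v) then false else r x y

module _ {r : Fin n → Fin n → Bool} {v : Fin n} where

  open DecMembership (_≟_ {n}) using (_∈?_)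

  ∖⁺ : ∀ {x y} → v ≢ x → v ≢ y → r x y ≡ true → (r ∖ v) x y ≡ true
  ∖⁺ {x} {y} v≢x v≢y rxy
    rewrite dec-false (x ≟ v) (v≢x ∘ sym) | dec-false (y ≟ v) (v≢y ∘ sym) = rxy

  ∖⁻ : ∀ {x y} → (r ∖ v) x y ≡ true → v ≢ x × v ≢ y × r x y ≡ true
  ∖⁻ {x} {y} e with x ≟ v | y ≟ v
  ∖⁻ () | yes _ | _
  ∖⁻ () | no  _ | yes _
  ... | no x≢v | no y≢v = x≢v ∘ sym , y≢v ∘ sym , e

  ∖-sym : (∀ x y → r x y ≡ r y x) → ∀ x y → (r ∖ v) x y ≡ (r ∖ v) y x
  ∖-sym r-sym x y = cong₂ (λ b c → if b then false else c) (∨-comm (does (x ≟ v)) _) (r-sym x y)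

  avoiding : ∀ {x y} (w : Walk r x y) → v ∉ vertices r w → Walk (r ∖ v) x y
  avoiding []      _   = []
  avoiding (e ∷ w) v∉w = ∖⁺ (v∉w ∘ here) (λ { refl → v∉w (there (start∈vertices w)) }) e
                       ∷ avoiding w (v∉w ∘ there)

  ∖-avoids : ∀ {x y} → v ≢ x → (w : Walk (r ∖ v) x y) → All (v ≢_) (vertices (r ∖ v) w)
  ∖-avoids v≢x []      = v≢x ∷ []
  ∖-avoids v≢x (e ∷ w) = v≢x ∷ ∖-avoids (proj₁ (proj₂ (∖⁻ e))) w

  unlinked⇒internal : ∀ {y z} → v ≢ y → v ≢ z → ¬ Walk (r ∖ v) y z →
    (p : Walk r y z) → v ∈ internal r p
  unlinked⇒internal v≢y v≢z unlinked p with v ∈? vertices r p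
  ... | yes v∈p = ∈-internal p v∈p v≢y v≢z
  ... | no  v∉p = ⊥-elim (unlinked (avoiding p v∉p))

neighbours-unlinked : {r : Fin n → Fin n → Bool} → (∀ x y → r x y ≡ r y x) → Acyclic r →
  ∀ {v a b} → r v a ≡ true → r v b ≡ true → a ≢ b → ¬ Walk (r ∖ v) a b
neighbours-unlinked {r = r} r-sym r-acyclic {v} {a} {b} va vb a≢b w with toPath w
... | [] , _ = a≢b refl
... | p@(e ∷ q) , p-path = r-acyclic v cycle (3≤length , cycle-unique)
  where
  p′ : Walk r a b
  p′ = mapWalk (λ e → proj₂ (proj₂ (∖⁻ {r = r} {v = v} e))) p
  cycle : Walk r v v
  cycle = va ∷ (p′ ◅◅ (trans (r-sym b v) vb ∷ []))
  cycle-vertices : initVertices r cycle ≡ v ∷ vertices (r ∖ v) p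
  cycle-vertices = cong (v ∷_) (trans (initVertices-◅◅-edge p′ _) (vertices-mapWalk _ p))
  3≤length : 3 ≤ length (initVertices r cycle)
  3≤length = subst (λ vs → 3 ≤ length vs) (sym cycle-vertices) (s≤s (s≤s (1≤length-vertices q)))
  cycle-unique : Unique (initVertices r cycle)
  cycle-unique = subst Unique (sym cycle-vertices) (∖-avoids (proj₁ (∖⁻ {r = r} e)) p ∷ p-path)

Inner : (Fin n → Fin n → Bool) → Fin n → Set
Inner r m = ∃₂ λ a b → a ≢ b × r m a ≡ true × r m b ≡ true

inner? : (r : Fin n → Fin n → Bool) → ∀ m → Dec (Inner r m)
inner? r m = any? λ a → any? λ b → ¬? (a ≟ b) ×-dec (r m a ≟ᵇ true) ×-dec (r m b ≟ᵇ true)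

adj⇒≢ : (G : Graph n) → ∀ {x y} → adj G x y ≡ true → x ≢ y
adj⇒≢ G {x} e refl with () ← trans (sym e) (irrefl G x)

tadj⇒≢ : {G : Graph n} (t : SpanningTree G) → ∀ {x y} → tadj t x y ≡ true → x ≢ y
tadj⇒≢ {G = G} t {x} {y} e = adj⇒≢ G (subgraph t x y e)

tadj-sym : {G : Graph n} (t : SpanningTree G) → ∀ {x y} → tadj t x y ≡ true → tadj t y x ≡ true
tadj-sym t {x} {y} e = trans (tsym t y x) e

module Independent {k} {G : Graph n} (T : Fin k → SpanningTree G) (independent : CompletelyIndependent T) where

  shared-edge : ∀ {i j x y} → i ≢ j → tadj (T i) x y ≡ true → tadj (T j) x y ≡ true → ⊥
  shared-edge {i} {j} {x} {y} i≢j e e′ =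
    proj₁ (independent i j i≢j x y (e ∷ []) (e′ ∷ []) edge-path edge-path)
      (x , y) (x , y) (here refl) (here refl) (inj₁ (refl , refl))
    where
    edge-path : Unique (x ∷ y ∷ [])
    edge-path = (tadj⇒≢ (T i) e ∷ []) ∷ [] ∷ []

  -- The vertices other than v linked in T_i − v, resp. T_j − v, form two partitions with at least two
  -- blocks each; a pair separated by both is joined in T_i and in T_j only through v.
  inner-unique : ∀ {i j v} → i ≢ j → Inner (tadj (T i)) v → Inner (tadj (T j)) v → ⊥
  inner-unique {i} {j} {v} i≢j (a , b , a≢b , va , vb) (c , d , c≢d , vc , vd) =
    ¬¬-jointlyUnrelated (linked-isPE i) (linked-isPE j)
      {neighbour i va} {neighbour i vb} {neighbour j vc} {neighbour j vd}
      (unlinked i va vb a≢b) (unlinked j vc vd c≢d) meet-at-v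
    where
    V : Set
    V = Σ (Fin n) (v ≢_)
    Linked : Fin k → V → V → Set
    Linked l y z = Walk (tadj (T l) ∖ v) (proj₁ y) (proj₁ z)
    linked-isPE : ∀ l → IsPartialEquivalence (Linked l)
    linked-isPE l = record { sym = reverse (∖-sym (tsym (T l))) ; trans = _◅◅_ }
    neighbour : ∀ l {y} → tadj (T l) v y ≡ true → V
    neighbour l {y} vy = y , tadj⇒≢ (T l) vy
    unlinked : ∀ l {y z} (vy : tadj (T l) v y ≡ true) (vz : tadj (T l) v z ≡ true) → y ≢ z →
      ¬ Linked l (neighbour l vy) (neighbour l vz)
    unlinked l = neighbours-unlinked (tsym (T l)) (acyclic (T l))
    path-through-v : ∀ l (y z : V) → ¬ Linked l y z →
      Σ (Walk (tadj (T l)) (proj₁ y) (proj₁ z)) λ p → IsPath (tadj (T l)) p × v ∈ internal (tadj (T l)) p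
    path-through-v l (y , v≢y) (z , v≢z) unlinked-yz =
      let p , p-path = toPath (connected (T l) y z)
      in  p , p-path , unlinked⇒internal v≢y v≢z unlinked-yz p
    meet-at-v : ¬ ∃₂ λ y z → ¬ Linked i y z × ¬ Linked j y z
    meet-at-v (y , z , unlinkedᵢ , unlinkedⱼ) =
      let p , p-path , v∈p = path-through-v i y z unlinkedᵢ
          q , q-path , v∈q = path-through-v j y z unlinkedⱼ
      in  proj₂ (independent i j i≢j _ _ p q p-path q-path) v v∈p v∈q

  inner-neighbour : ∀ {i j x y} → i ≢ j → tadj (T j) x y ≡ true →
    ∃ λ m → tadj (T i) x m ≡ true × Inner (tadj (T i)) m
  inner-neighbour {i} {j} {x} {y} i≢j xy with toPath (connected (T i) x y)
  ... | [] , _ = ⊥-elim (tadj⇒≢ (T j) xy refl)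
  ... | (xy′ ∷ []) , _ = ⊥-elim (shared-edge i≢j xy′ xy)
  ... | (_∷_ {y = m} xm (_∷_ {y = m′} mm′ rest)) , ((_ ∷ x≢rest) ∷ _) =
    m , xm , x , m′ , All.lookup x≢rest (start∈vertices rest) , tadj-sym (T i) xm , mm′

module _ {G : Graph n} {inD : Fin n → Bool} where

  I-neighbour∈D : IsSplit G inD → ∀ {x m} → inD x ≡ false → adj G x m ≡ true → inD m ≡ true
  I-neighbour∈D split {x} {m} x∈I xm with inD m in m∈?
  ... | true  = refl
  ... | false with () ← trans (sym xm) (IsSplit.independent split x m x∈I m∈?)

  panchromatic-injective : ∀ {k c} → Uniform G inD k → Panchromatic G inD k c →
    ∀ {x q w} → inD x ≡ false → adj G x q ≡ true → adj G x w ≡ true → c q ≡ c w → q ≡ w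
  panchromatic-injective {k} {c} uniform panchromatic {x} {q} {w} x∈I xq xw cq≡cw = begin
    q        ≡⟨ sym (f∘c xq) ⟩
    f (c q)  ≡⟨ cong f cq≡cw ⟩
    f (c w)  ≡⟨ f∘c xw ⟩
    w        ∎
    where
    open ≡-Reasoning
    f : Fin k → Fin n
    f l = proj₁ (panchromatic x x∈I l)
    c∘f : ∀ l → c (f l) ≡ l
    c∘f l = proj₂ (proj₂ (panchromatic x x∈I l))
    f∘c : ∀ {v} → adj G x v ≡ true → f (c v) ≡ v
    f∘c xv =
      let l , fl≡v = countB≤-injection-onto (adj G x) (≤-reflexive (uniform x x∈I)) f
                       (λ {l} {l′} fl≡fl′ → trans (sym (c∘f l)) (trans (cong c fl≡fl′) (c∘f l′)))
                       (λ l → proj₁ (proj₂ (panchromatic x x∈I l))) xv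
      in  subst (λ u → f (c u) ≡ u) fl≡v (cong f (c∘f l))

hasUniqueColour⇒ : ∀ {k} {inD : Fin n → Bool} {c : Fin n → Fin k} {v} →
  hasUniqueColour inD c v ≡ true →
  inD v ≡ true × (∀ w → inD w ≡ true → c w ≡ c v → w ≡ v)
hasUniqueColour⇒ {n} {inD = inD} {c} {v} unique with inD v in v∈D
... | true = refl , λ w w∈D cw≡cv →
  countB≡1⇒unique colour-class count≡1
    (cong₂ _∧_ w∈D (dec-true (c w ≟ c v) cw≡cv)) (cong₂ _∧_ v∈D (dec-true (c v ≟ c v) refl))
  where
  colour-class : Fin n → Bool
  colour-class w = inD w ∧ does (c w ≟ c v)
  count≡1 : countB colour-class ≡ 1
  count≡1 = ≡ᵇ⇒≡ (countB colour-class) 1 (subst T (sym unique) tt)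

module TreeColouring {k′} {G : Graph n} {inD : Fin n → Bool} (split : IsSplit G inD)
         (uniform : Uniform G inD (suc (suc k′)))
         (T : Fin (suc (suc k′)) → SpanningTree G) (independent : CompletelyIndependent T) where

  open Independent T independent

  I-has-neighbour : ∀ {x} → inD x ≡ false → ∃ λ y → adj G x y ≡ true
  I-has-neighbour {x} x∈I = countB-pos (adj G x) (subst (1 ≤_) (sym (uniform x x∈I)) (s≤s z≤n))

  tree-neighbour : ∀ {x y} → x ≢ y → ∀ i → ∃ λ m → tadj (T i) x m ≡ true
  tree-neighbour {x} {y} x≢y i with connected (T i) x y
  ... | []                = ⊥-elim (x≢y refl)
  ... | _∷_ {y = m} xm _ = m , xm

  inner-neighbour-of-edge : ∀ {x y} → adj G x y ≡ true → ∀ i →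
    ∃ λ m → tadj (T i) x m ≡ true × Inner (tadj (T i)) m
  inner-neighbour-of-edge xy i =
    let m , xm = tree-neighbour (adj⇒≢ G xy) (punchIn i zero)
    in  inner-neighbour (punchInᵢ≢i i zero ∘ sym) xm

  colour : Fin n → Fin (suc (suc k′))
  colour m with any? (λ i → inner? (tadj (T i)) m)
  ... | yes (i , _) = i
  ... | no  _       = zero

  colour-inner : ∀ {i m} → Inner (tadj (T i)) m → colour m ≡ i
  colour-inner {i} {m} m-inner with any? (λ i → inner? (tadj (T i)) m)
  ... | yes (j , m-innerⱼ) = decidable-stable (j ≟ i) λ j≢i → inner-unique j≢i m-innerⱼ m-inner
  ... | no  none           = ⊥-elim (none (i , m-inner))

  colour-panchromatic : Panchromatic G inD (suc (suc k′)) colour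
  colour-panchromatic x x∈I i =
    let y , xy = I-has-neighbour x∈I
        m , xm , m-inner = inner-neighbour-of-edge xy i
    in  m , subgraph (T i) x m xm , colour-inner m-inner

  no-unique-colour : ∀ {v} → inD v ≡ true → (∀ w → inD w ≡ true → colour w ≡ colour v → w ≡ v) → ⊥
  no-unique-colour {v} v∈D unique = no-D-neighbour-of-v D-neighbour-of-v
    where
    i j : Fin (suc (suc k′))
    i = colour v
    j = punchIn i zero
    j≢i : j ≢ i
    j≢i = punchInᵢ≢i i zero
    i≢j : i ≢ j
    i≢j = j≢i ∘ sym

    I-adjacent-to-v : ∀ {x} → inD x ≡ false → tadj (T i) x v ≡ true
    I-adjacent-to-v {x} x∈I =
      let y , xy = I-has-neighbour x∈I
          m , xm , m-inner = inner-neighbour-of-edge xy i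
          m≡v = unique m (I-neighbour∈D split x∈I (subgraph (T i) x m xm)) (colour-inner m-inner)
      in  subst (λ u → tadj (T i) x u ≡ true) m≡v xm

    D-neighbour-of-v : ∃ λ w → inD w ≡ true × tadj (T j) v w ≡ true × colour w ≡ j
    D-neighbour-of-v with IsSplit.dominated split v v∈D
    ... | x , x∈I , _ with inner-neighbour j≢i (tadj-sym (T i) (I-adjacent-to-v x∈I))
    ...   | w , vw , w-inner with inD w in w∈?
    ...     | true  = w , w∈? , vw , colour-inner w-inner
    ...     | false = ⊥-elim (shared-edge i≢j (tadj-sym (T i) (I-adjacent-to-v w∈?)) vw)

    I-neighbour-of-w : ∀ {w} → tadj (T j) v w ≡ true → ∃ λ p → inD p ≡ false × tadj (T i) w p ≡ true
    I-neighbour-of-w {w} vw with inner-neighbour i≢j (tadj-sym (T j) vw)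
    ... | p , wp , p-inner with inD p in p∈?
    ...   | false = p , p∈? , wp
    ...   | true  = ⊥-elim (shared-edge i≢j
                      (subst (λ u → tadj (T i) w u ≡ true) (unique p p∈? (colour-inner p-inner)) wp)
                      (tadj-sym (T j) vw))

    no-D-neighbour-of-v : (∃ λ w → inD w ≡ true × tadj (T j) v w ≡ true × colour w ≡ j) → ⊥
    no-D-neighbour-of-v (w , w∈D , vw , colour-w) with I-neighbour-of-w vw
    ... | p , p∈I , wp with inner-neighbour j≢i (tadj-sym (T i) wp)
    ...   | q , pq , q-inner =
      shared-edge i≢j (tadj-sym (T i) wp) (subst (λ u → tadj (T j) p u ≡ true) q≡w pq)
      where
      q≡w : q ≡ w
      q≡w = panchromatic-injective {G = G} {inD} uniform colour-panchromatic p∈I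
              (subgraph (T j) p q pq) (subgraph (T i) p w (tadj-sym (T i) wp))
              (trans (colour-inner q-inner) (sym colour-w))

corollary1 : (k : ℕ) → 2 ≤ k → {n : ℕ} → (G : Graph n) → (inD : Fin n → Bool) →
    IsSplit G inD → Uniform G inD k →
    (∃ λ (c : Fin n → Fin k) → Panchromatic G inD k c) →
    AlphaAtLeast1 G inD k →
    ¬ (∃ λ (T : Fin k → SpanningTree G) → CompletelyIndependent T)
corollary1 (suc (suc k′)) (s≤s (s≤s z≤n)) G inD split uniform _ α≥1 (T , independent) =
  let v , v-unique = countB-pos (hasUniqueColour inD colour) (α≥1 colour colour-panchromatic)
      v∈D , colour-unique = hasUniqueColour⇒ v-unique
  in  no-unique-colour v∈D colour-unique
  where open TreeColouring split uniform T independent
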